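{- Let $G_1$ be a $d^{(1)}$-regular and $G_2$ a $d^{(2)}$-regular finite simple graph, and let $V_1,\dots,V_k$ be the coloring classes of a FAT $k$-coloring of $G_1$ with parameter $\alpha$. Then the Cartesian product $G_1\square G_2$ and the strong product $G_1\boxtimes G_2$ each admit a FAT $k$-coloring with parameters \[ \frac{\alpha d^{(1)}}{d^{(1)}+d^{(2)}}\quad\text{and}\quad \frac{\alpha\bigl(d^{(1)}+d^{(1)}d^{(2)}\bigr)}{d^{(1)}+d^{(2)}+d^{(1)}d^{(2)}}, \] respectively. In both cases the coloring classes are $V_i\times V(G_2)$, $i=1,\dots,k$.
   Context: All products have vertex set $V(G_1)\times V(G_2)$. In the Cartesian product $G_1\square G_2$, $(u_1,u_2)\sim(v_1,v_2)$ iff ($u_1=v_1$ and $u_2\sim v_2$) or ($u_1\sim v_1$ and $u_2=v_2$). In the tensor product $G_1\times G_2$, $(u_1,u_2)\sim(v_1,v_2)$ iff $u_1\sim v_1$ and $u_2\sim v_2$. The strong product $G_1\boxtimes G_2$ has edge set the union of the edge sets of $G_1\times G_2$ and $G_1\square G_2$. A $k$-coloring with classes $V_1,\dots,V_k$ is FAT with parameter $\alpha\in[0,1]$ if, with $\beta:=1-(k-1)\alpha$, every vertex $v$ satisfies $e(v,V_i)=\alpha\deg v$ for each $V_i\not\ni v$ and $e(v,V_i)=\beta\deg v$ for $V_i\ni v$, where $e(v,S)$ is the number of neighbors of $v$ in $S$.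
   Formalization: The FAT parameter α of the coloring of $G_1$ ranges over the rationals in [0,1]. -}

module Defs where

open import Data.Bool using (Bool; true; false; _∧_; _∨_; if_then_else_)
open import Data.Nat using (ℕ; zero; suc; _*_)
open import Data.Fin using (Fin; zero; suc; _≟_; remQuot)
open import Data.Product using (_×_; _,_; proj₁; proj₂)
open import Data.Rational using (ℚ; 0ℚ; 1ℚ; _≤_; _-_) renaming (_*_ to _*ℚ_)
import Data.Rational as ℚ
open import Data.Integer using (+_)
open import Data.Nat using (NonZero; _+_)
open import Data.Nat.Properties using (m+n≡0⇒m≡0)
open import Relation.Nullary.Decidable using (⌊_⌋)
open import Relation.Binary.PropositionalEquality using (_≡_; _≢_)

Adj : ℕ → Set
Adj n = Fin n → Fin n → Bool

record IsSimple {n : ℕ} (G : Adj n) : Set where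
  field
    sym   : ∀ u v → G u v ≡ G v u
    loopless : ∀ v → G v v ≡ false

count : {n : ℕ} → (Fin n → Bool) → ℕ
count {zero}  p = 0
count {suc n} p = (if p zero then 1 else 0) Data.Nat.+ count (λ i → p (suc i))

deg : {n : ℕ} → Adj n → Fin n → ℕ
deg G v = count (G v)

IsRegular : {n : ℕ} → Adj n → ℕ → Set
IsRegular G d = ∀ v → deg G v ≡ d

eClass : {n k : ℕ} → Adj n → (Fin n → Fin k) → Fin n → Fin k → ℕ
eClass G c v i = count (λ u → G v u ∧ ⌊ c u ≟ i ⌋)

toℚ : ℕ → ℚ
toℚ n = (+ n) ℚ./ 1

fatβ : ℕ → ℚ → ℚ
fatβ k α = 1ℚ - (toℚ (k Data.Nat.∸ 1) *ℚ α)

-- FAT k-coloring with parameter α (classes V_i = c⁻¹(i), i : Fin k)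
record IsFAT {n k : ℕ} (G : Adj n) (c : Fin n → Fin k) (α : ℚ) : Set where
  field
    α≥0   : 0ℚ ≤ α
    α≤1   : α ≤ 1ℚ
    other : ∀ v i → c v ≢ i → toℚ (eClass G c v i) ≡ α *ℚ toℚ (deg G v)
    own   : ∀ v → toℚ (eClass G c v (c v)) ≡ fatβ k α *ℚ toℚ (deg G v)

-- Products, with vertex set Fin (n₁ * n₂) ≅ Fin n₁ × Fin n₂ via remQuot.
eqB : {n : ℕ} → Fin n → Fin n → Bool
eqB u v = ⌊ u ≟ v ⌋

cartesian : {n₁ n₂ : ℕ} → Adj n₁ → Adj n₂ → Adj (n₁ * n₂)
cartesian {n₁} {n₂} G₁ G₂ x y with remQuot n₂ x | remQuot n₂ y
... | (u₁ , u₂) | (v₁ , v₂) = (eqB u₁ v₁ ∧ G₂ u₂ v₂) ∨ (G₁ u₁ v₁ ∧ eqB u₂ v₂)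

tensor : {n₁ n₂ : ℕ} → Adj n₁ → Adj n₂ → Adj (n₁ * n₂)
tensor {n₁} {n₂} G₁ G₂ x y with remQuot n₂ x | remQuot n₂ y
... | (u₁ , u₂) | (v₁ , v₂) = G₁ u₁ v₁ ∧ G₂ u₂ v₂

strong : {n₁ n₂ : ℕ} → Adj n₁ → Adj n₂ → Adj (n₁ * n₂)
strong G₁ G₂ x y = tensor G₁ G₂ x y ∨ cartesian G₁ G₂ x y

liftColor : {n₁ n₂ k : ℕ} → (Fin n₁ → Fin k) → Fin (n₁ * n₂) → Fin k
liftColor {n₁} {n₂} c x = c (proj₁ (remQuot n₂ x))

nz-strong : (d₁ d₂ : ℕ) → .{{NonZero (d₁ + d₂)}} → NonZero (d₁ + d₂ + d₁ * d₂)
nz-strong d₁ d₂ {{nz}} = Data.Nat.≢-nonZero (λ e → Data.Nat.≢-nonZero⁻¹ (d₁ + d₂) {{nz}} (m+n≡0⇒m≡0 (d₁ + d₂) e))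

cartParam : (d₁ d₂ : ℕ) → .{{NonZero (d₁ + d₂)}} → ℚ → ℚ
cartParam d₁ d₂ α = α *ℚ ((+ d₁) ℚ./ (d₁ + d₂))

strongParam : (d₁ d₂ : ℕ) → .{{NonZero (d₁ + d₂)}} → ℚ → ℚ
strongParam d₁ d₂ α = α *ℚ ((+ (d₁ + d₁ * d₂)) ℚ./ (d₁ + d₂ + d₁ * d₂)) {{nz-strong d₁ d₂}}

-- A vertex (v, w) of either product has, inside a class Vᵢ × V(G₂), [v ∈ Vᵢ]·d₂ neighbours
-- in its own fibre {v} × V(G₂) and m neighbours in the fibre of each G₁-neighbour of v in Vᵢ,
-- with m = 1 for the Cartesian and m = d₂ + 1 for the strong product. So
-- e((v, w), Vᵢ × V(G₂)) = [v ∈ Vᵢ]·d₂ + m·e(v, Vᵢ) and deg (v, w) = d₂ + m·d₁, and the FAT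
-- equations of G₁ become those of the product for the parameter α·m·d₁ / (d₂ + m·d₁).
module Submission where

open import Defs
open import Data.Bool using (Bool; true; false; _∧_; _∨_; if_then_else_)
open import Data.Bool.Properties using (∧-comm; ∧-identityʳ; ∧-zeroʳ; ∨-identityʳ)
open import Data.Fin using (Fin; zero; suc; _↑ˡ_; _↑ʳ_; combine; remQuot; _≟_)
open import Data.Fin.Properties using (remQuot-combine; combine-remQuot; suc-injective)
open import Data.Integer using (+_)
import Data.Integer as ℤ
import Data.Integer.Properties as ℤ
open import Data.Nat using (ℕ; zero; suc; _+_; _*_; _∸_; NonZero; ≢-nonZero; ≢-nonZero⁻¹)
  renaming (_≤_ to _≤ℕ_)
open import Data.Nat.Properties
  using (+-*-semiring; +-assoc; +-comm; +-suc; +-identityʳ; *-identityˡ; *-identityʳ; *-zeroʳ; *-suc; m≤n+m)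
open import Algebra.Properties.Semiring.Sum +-*-semiring
  using (sum; sum-syntax; sum-cong-≗; sum-replicate-zero; ∑-distrib-+; *-distribʳ-sum)
open import Data.Nat.Solver using (module +-*-Solver)
open import Data.Product using (_×_; _,_; proj₁; proj₂)
open import Data.Rational using (ℚ; _/_; _≤_; 0ℚ; 1ℚ; toℚᵘ; nonNegative)
  renaming (_+_ to _+ℚ_; _*_ to _*ℚ_; _-_ to _-ℚ_)
open import Data.Rational.Properties
  using ( toℚᵘ-injective; toℚᵘ-fromℚᵘ; toℚᵘ-homo-+; toℚᵘ-homo-*; toℚᵘ-cancel-≤
        ; normalize-nonNeg; nonNegative⁻¹; nonNeg*nonNeg⇒nonNeg; *-monoˡ-≤-nonNeg; ≤-trans)
import Data.Rational.Properties as ℚ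
import Data.Rational.Solver as ℚ-Solver
open import Data.Rational.Unnormalised as ℚᵘ using (mkℚᵘ; *≡*; *≤*; _≃_)
import Data.Rational.Unnormalised.Properties as ℚᵘ
open import Function using (_∘_)
open import Relation.Binary.PropositionalEquality
open import Relation.Nullary using (yes; no)
open import Relation.Nullary.Decidable using (isYes≗does; dec-true; dec-false; ⌊⌋-map′)

iverson : Bool → ℕ
iverson b = if b then 1 else 0

iverson-∧ : ∀ a b → iverson (a ∧ b) ≡ iverson a * iverson b
iverson-∧ true  b = sym (+-identityʳ (iverson b))
iverson-∧ false b = refl

eqB-refl : ∀ {n} (u : Fin n) → eqB u u ≡ true
eqB-refl u = trans (isYes≗does (u ≟ u)) (dec-true (u ≟ u) refl)

eqB-≢ : ∀ {n} {u v : Fin n} → u ≢ v → eqB u v ≡ false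
eqB-≢ {u = u} {v} u≢v = trans (isYes≗does (u ≟ v)) (dec-false (u ≟ v) u≢v)

eqB-suc : ∀ {n} (u v : Fin n) → eqB (suc u) (suc v) ≡ eqB u v
eqB-suc u v = ⌊⌋-map′ (cong suc) suc-injective (u ≟ v)

Loopless : ∀ {n} → Adj n → Set
Loopless G = ∀ v → G v v ≡ false

eqB-∧-loopless : ∀ {n} {G : Adj n} → Loopless G → ∀ v u → eqB v u ∧ G v u ≡ false
eqB-∧-loopless loopless v u with v ≟ u
... | yes refl = loopless v
... | no  _    = refl

∑-↑ : ∀ m {n} (f : Fin (m + n) → ℕ) → sum f ≡ sum (f ∘ (_↑ˡ n)) + sum (f ∘ (m ↑ʳ_))
∑-↑ zero    f = refl
∑-↑ (suc m) f = trans (cong (_+_ (f zero)) (∑-↑ m (f ∘ suc))) (sym (+-assoc (f zero) _ _))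

∑-combine : ∀ m {n} (f : Fin (m * n) → ℕ) → sum f ≡ ∑[ i < m ] ∑[ j < n ] f (combine i j)
∑-combine zero        f = refl
∑-combine (suc m) {n} f =
  trans (∑-↑ n f) (cong (_+_ (sum (f ∘ (_↑ˡ (m * n))))) (∑-combine m (f ∘ (n ↑ʳ_))))

∑-δ : ∀ {n} (v : Fin n) (g : Fin n → ℕ) → ∑[ u < n ] (iverson (eqB v u) * g u) ≡ g v
∑-δ {suc n} zero g = begin
  g zero + 0 + ∑[ u < n ] 0  ≡⟨ cong (_+_ (g zero + 0)) (sum-replicate-zero n) ⟩
  g zero + 0 + 0             ≡⟨ +-identityʳ (g zero + 0) ⟩
  g zero + 0                 ≡⟨ +-identityʳ (g zero) ⟩
  g zero                     ∎
  where open ≡-Reasoning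
∑-δ {suc n} (suc v) g =
  trans (sum-cong-≗ (λ u → cong (λ b → iverson b * g (suc u)) (eqB-suc v u))) (∑-δ v (g ∘ suc))

count≡∑ : ∀ {n} (p : Fin n → Bool) → count p ≡ ∑[ i < n ] iverson (p i)
count≡∑ {zero}  p = refl
count≡∑ {suc n} p = cong (_+_ (iverson (p zero))) (count≡∑ (p ∘ suc))

count-cong : ∀ {n} {p q : Fin n → Bool} → (∀ i → p i ≡ q i) → count p ≡ count q
count-cong {p = p} {q} p≗q = begin
  count p            ≡⟨ count≡∑ p ⟩
  sum (iverson ∘ p)  ≡⟨ sum-cong-≗ (cong iverson ∘ p≗q) ⟩
  sum (iverson ∘ q)  ≡⟨ count≡∑ q ⟨
  count q            ∎
  where open ≡-Reasoning

count-false : ∀ n → count {n} (λ _ → false) ≡ 0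
count-false zero    = refl
count-false (suc n) = count-false n

count-∧ʳ : ∀ {n} (p : Fin n → Bool) b → count (λ i → p i ∧ b) ≡ count p * iverson b
count-∧ʳ p true  = trans (count-cong (∧-identityʳ ∘ p)) (sym (*-identityʳ (count p)))
count-∧ʳ {n} p false = trans (count-cong (∧-zeroʳ ∘ p)) (trans (count-false n) (sym (*-zeroʳ (count p))))

count-∨ : ∀ {n} {p q : Fin n → Bool} → (∀ i → p i ∧ q i ≡ false) →
          count (λ i → p i ∨ q i) ≡ count p + count q
count-∨ {zero}          disjoint = refl
count-∨ {suc n} {p} {q} disjoint with p zero | q zero | disjoint zero
... | true  | false | _ = cong suc (count-∨ (disjoint ∘ suc))
... | false | true  | _ = trans (cong suc (count-∨ (disjoint ∘ suc))) (sym (+-suc _ _))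
... | false | false | _ = count-∨ (disjoint ∘ suc)
... | true  | true  | ()

count-select : ∀ {n} a b (p q : Fin n → Bool) → a ∧ b ≡ false →
               count (λ i → (a ∧ p i) ∨ (b ∧ q i)) ≡ iverson a * count p + iverson b * count q
count-select true  false p q _ = begin
  count (λ i → p i ∨ false)  ≡⟨ count-cong (∨-identityʳ ∘ p) ⟩
  count p                    ≡⟨ +-identityʳ (count p) ⟨
  count p + 0                ≡⟨ +-identityʳ (count p + 0) ⟨
  count p + 0 + 0            ∎
  where open ≡-Reasoning
count-select false true  p q _ = sym (+-identityʳ (count q))
count-select {n} false false p q _ = count-false n
count-select true  true  p q ()

count-eqB : ∀ {n} (w : Fin n) → count (eqB w) ≡ 1
count-eqB {n} w = begin
  count (eqB w)                           ≡⟨ count≡∑ (eqB w) ⟩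
  ∑[ u < n ] iverson (eqB w u)            ≡⟨ sum-cong-≗ (λ u → sym (*-identityʳ (iverson (eqB w u)))) ⟩
  ∑[ u < n ] (iverson (eqB w u) * 1)      ≡⟨ ∑-δ w (λ _ → 1) ⟩
  1                                       ∎
  where open ≡-Reasoning

toℚᵘ-toℚ : ∀ n → toℚᵘ (toℚ n) ≃ mkℚᵘ (+ n) 0
toℚᵘ-toℚ n = toℚᵘ-fromℚᵘ (mkℚᵘ (+ n) 0)

toℚ-homo-+ : ∀ m n → toℚ (m + n) ≡ toℚ m +ℚ toℚ n
toℚ-homo-+ m n = toℚᵘ-injective (begin
  toℚᵘ (toℚ (m + n))                ≈⟨ toℚᵘ-toℚ (m + n) ⟩
  mkℚᵘ (+ (m + n)) 0                ≈⟨ *≡* (cong (ℤ._* + 1) +[m+n]≡+m*1++n*1) ⟩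
  mkℚᵘ (+ m) 0 ℚᵘ.+ mkℚᵘ (+ n) 0    ≈⟨ ℚᵘ.+-cong (toℚᵘ-toℚ m) (toℚᵘ-toℚ n) ⟨
  toℚᵘ (toℚ m) ℚᵘ.+ toℚᵘ (toℚ n)    ≈⟨ toℚᵘ-homo-+ (toℚ m) (toℚ n) ⟨
  toℚᵘ (toℚ m +ℚ toℚ n)             ∎)
  where
  open ℚᵘ.≃-Reasoning
  +[m+n]≡+m*1++n*1 : + (m + n) ≡ + m ℤ.* + 1 ℤ.+ + n ℤ.* + 1
  +[m+n]≡+m*1++n*1 = trans (ℤ.pos-+ m n) (sym (cong₂ ℤ._+_ (ℤ.*-identityʳ (+ m)) (ℤ.*-identityʳ (+ n))))

toℚ-homo-* : ∀ m n → toℚ (m * n) ≡ toℚ m *ℚ toℚ n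
toℚ-homo-* m n = toℚᵘ-injective (begin
  toℚᵘ (toℚ (m * n))                ≈⟨ toℚᵘ-toℚ (m * n) ⟩
  mkℚᵘ (+ (m * n)) 0                ≈⟨ *≡* (cong (ℤ._* + 1) (ℤ.pos-* m n)) ⟩
  mkℚᵘ (+ m) 0 ℚᵘ.* mkℚᵘ (+ n) 0    ≈⟨ ℚᵘ.*-cong (toℚᵘ-toℚ m) (toℚᵘ-toℚ n) ⟨
  toℚᵘ (toℚ m) ℚᵘ.* toℚᵘ (toℚ n)    ≈⟨ toℚᵘ-homo-* (toℚ m) (toℚ n) ⟨
  toℚᵘ (toℚ m *ℚ toℚ n)             ∎)
  where open ℚᵘ.≃-Reasoning

n/d*d≡n : ∀ n d .{{_ : NonZero d}} → (+ n / d) *ℚ toℚ d ≡ toℚ n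
n/d*d≡n n (suc d) = toℚᵘ-injective (begin
  toℚᵘ ((+ n / suc d) *ℚ toℚ (suc d))           ≈⟨ toℚᵘ-homo-* (+ n / suc d) (toℚ (suc d)) ⟩
  toℚᵘ (+ n / suc d) ℚᵘ.* toℚᵘ (toℚ (suc d))
    ≈⟨ ℚᵘ.*-cong (toℚᵘ-fromℚᵘ (mkℚᵘ (+ n) d)) (toℚᵘ-toℚ (suc d)) ⟩
  mkℚᵘ (+ n) d ℚᵘ.* mkℚᵘ (+ suc d) 0
    ≈⟨ *≡* (trans (ℤ.*-identityʳ _) (cong (+ n ℤ.*_) (sym (ℤ.*-identityʳ (+ suc d))))) ⟩
  mkℚᵘ (+ n) 0                                  ≈⟨ toℚᵘ-toℚ n ⟨
  toℚᵘ (toℚ n)                                  ∎)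
  where open ℚᵘ.≃-Reasoning

0≤n/d : ∀ n d .{{_ : NonZero d}} → 0ℚ ≤ + n / d
0≤n/d n d = nonNegative⁻¹ (+ n / d) {{normalize-nonNeg n d}}

n/d≤1 : ∀ {n d} .{{_ : NonZero d}} → n ≤ℕ d → + n / d ≤ 1ℚ
n/d≤1 {n} {suc d} n≤d = toℚᵘ-cancel-≤ (ℚᵘ.≤-respˡ-≃ (ℚᵘ.≃-sym (toℚᵘ-fromℚᵘ (mkℚᵘ (+ n) d)))
  (*≤* (subst₂ ℤ._≤_ (sym (ℤ.*-identityʳ (+ n))) (sym (ℤ.*-identityˡ (+ suc d))) (ℤ.+≤+ n≤d))))

0≤p*q : ∀ {p q} → 0ℚ ≤ p → 0ℚ ≤ q → 0ℚ ≤ p *ℚ q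
0≤p*q {p} {q} 0≤p 0≤q =
  nonNegative⁻¹ (p *ℚ q) {{nonNeg*nonNeg⇒nonNeg p {{nonNegative 0≤p}} q {{nonNegative 0≤q}}}}

p*q≤1 : ∀ {p q} → 0ℚ ≤ p → p ≤ 1ℚ → q ≤ 1ℚ → p *ℚ q ≤ 1ℚ
p*q≤1 {p} {q} 0≤p p≤1 q≤1 =
  ≤-trans (subst (p *ℚ q ≤_) (ℚ.*-identityʳ p) (*-monoˡ-≤-nonNeg p {{nonNegative 0≤p}} q≤1)) p≤1

rescale-α : ∀ α {x} D A → x *ℚ D ≡ A → α *ℚ A ≡ (α *ℚ x) *ℚ D
rescale-α α {x} D A xD≡A = trans (cong (α *ℚ_) (sym xD≡A)) (sym (ℚ.*-assoc α x D))

rescale-fatβ : ∀ k α {x} B A → x *ℚ (B +ℚ A) ≡ A →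
               B +ℚ fatβ k α *ℚ A ≡ fatβ k (α *ℚ x) *ℚ (B +ℚ A)
rescale-fatβ k α {x} B A x[B+A]≡A = begin
  B +ℚ (1ℚ -ℚ t *ℚ α) *ℚ A
    ≡⟨ solve 4 (λ t α B A → B :+ (con 1ℚ :- t :* α) :* A := (B :+ A) :- t :* α :* A) refl t α B A ⟩
  (B +ℚ A) -ℚ t *ℚ α *ℚ A
    ≡⟨ cong (λ a → (B +ℚ A) -ℚ t *ℚ α *ℚ a) (sym x[B+A]≡A) ⟩
  (B +ℚ A) -ℚ t *ℚ α *ℚ (x *ℚ (B +ℚ A))
    ≡⟨ solve 5 (λ t α x B A → (B :+ A) :- t :* α :* (x :* (B :+ A)) := (con 1ℚ :- t :* (α :* x)) :* (B :+ A))
               refl t α x B A ⟩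
  (1ℚ -ℚ t *ℚ (α *ℚ x)) *ℚ (B +ℚ A)
    ∎
  where
  open ≡-Reasoning
  open ℚ-Solver.+-*-Solver
  t = toℚ (k ∸ 1)

-- A vertex y of H has b neighbours in its own fibre π⁻¹(π y), m in the fibre of each
-- G-neighbour of π y, and no others; stated for the union of the fibres over any P ⊆ V(G),
-- which is the shape of the lifted colour classes.
IsEquitableCover : ∀ {n₁ n} → Adj n → Adj n₁ → (Fin n → Fin n₁) → ℕ → ℕ → Set
IsEquitableCover {n₁} H G π b m = ∀ y (P : Fin n₁ → Bool) →
  count (λ z → H y z ∧ P (π z)) ≡ iverson (P (π y)) * b + count (λ u → G (π y) u ∧ P u) * m

module _ {n₁ n k b m d : ℕ} {G : Adj n₁} {H : Adj n} {π : Fin n → Fin n₁}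
         (cover : IsEquitableCover H G π b m) (regular : IsRegular G d) where

  deg-cover : ∀ y → deg H y ≡ b + d * m
  deg-cover y = begin
    count (H y)                                    ≡⟨ count-cong (λ z → sym (∧-identityʳ (H y z))) ⟩
    count (λ z → H y z ∧ true)                     ≡⟨ cover y (λ _ → true) ⟩
    1 * b + count (λ u → G (π y) u ∧ true) * m     ≡⟨ cong₂ _+_ (*-identityˡ b) (cong (_* m) degG) ⟩
    b + d * m                                      ∎
    where
    open ≡-Reasoning
    degG : count (λ u → G (π y) u ∧ true) ≡ d
    degG = trans (count-cong (∧-identityʳ ∘ G (π y))) (regular (π y))

  fat-lift : ∀ {c : Fin n₁ → Fin k} {α} .{{_ : NonZero (b + d * m)}} → IsFAT G c α →
             IsFAT H (c ∘ π) (α *ℚ (+ (d * m) / (b + d * m)))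
  fat-lift {c} {α} fat = record
    { α≥0   = 0≤p*q α≥0 (0≤n/d (d * m) (b + d * m))
    ; α≤1   = p*q≤1 α≥0 α≤1 (n/d≤1 (m≤n+m (d * m) b))
    ; other = otherᴴ
    ; own   = ownᴴ
    }
    where
    open IsFAT fat
    open ≡-Reasoning

    x : ℚ
    x = + (d * m) / (b + d * m)

    x-spec : x *ℚ (toℚ b +ℚ toℚ (d * m)) ≡ toℚ (d * m)
    x-spec = trans (cong (x *ℚ_) (sym (toℚ-homo-+ b (d * m)))) (n/d*d≡n (d * m) (b + d * m))

    degᴴ : ∀ y → toℚ (deg H y) ≡ toℚ b +ℚ toℚ (d * m)
    degᴴ y = trans (cong toℚ (deg-cover y)) (toℚ-homo-+ b (d * m))

    eClassᴴ : ∀ y i → eClass H (c ∘ π) y i ≡ iverson (eqB (c (π y)) i) * b + eClass G c (π y) i * m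
    eClassᴴ y i = cover y (λ u → eqB (c u) i)

    scaled : ∀ q v e → toℚ e ≡ q *ℚ toℚ (deg G v) → toℚ (e * m) ≡ q *ℚ toℚ (d * m)
    scaled q v e e≡q·deg = begin
      toℚ (e * m)                  ≡⟨ toℚ-homo-* e m ⟩
      toℚ e *ℚ toℚ m               ≡⟨ cong (_*ℚ toℚ m) (trans e≡q·deg (cong (λ δ → q *ℚ toℚ δ) (regular v))) ⟩
      q *ℚ toℚ d *ℚ toℚ m          ≡⟨ ℚ.*-assoc q (toℚ d) (toℚ m) ⟩
      q *ℚ (toℚ d *ℚ toℚ m)        ≡⟨ cong (q *ℚ_) (toℚ-homo-* d m) ⟨
      q *ℚ toℚ (d * m)             ∎

    otherᴴ : ∀ y i → c (π y) ≢ i → toℚ (eClass H (c ∘ π) y i) ≡ (α *ℚ x) *ℚ toℚ (deg H y)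
    otherᴴ y i cy≢i = begin
      toℚ (eClass H (c ∘ π) y i)               ≡⟨ cong toℚ (eClassᴴ y i) ⟩
      toℚ (iverson (eqB cy i) * b + e * m)     ≡⟨ cong (λ β → toℚ (iverson β * b + e * m)) (eqB-≢ cy≢i) ⟩
      toℚ (e * m)                              ≡⟨ scaled α (π y) e (other (π y) i cy≢i) ⟩
      α *ℚ toℚ (d * m)                         ≡⟨ rescale-α α (toℚ b +ℚ toℚ (d * m)) (toℚ (d * m)) x-spec ⟩
      (α *ℚ x) *ℚ (toℚ b +ℚ toℚ (d * m))       ≡⟨ cong ((α *ℚ x) *ℚ_) (degᴴ y) ⟨
      (α *ℚ x) *ℚ toℚ (deg H y)                ∎
      where
      cy = c (π y)
      e  = eClass G c (π y) i

    ownᴴ : ∀ y → toℚ (eClass H (c ∘ π) y (c (π y))) ≡ fatβ k (α *ℚ x) *ℚ toℚ (deg H y)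
    ownᴴ y = begin
      toℚ (eClass H (c ∘ π) y cy)                ≡⟨ cong toℚ (eClassᴴ y cy) ⟩
      toℚ (iverson (eqB cy cy) * b + e * m)      ≡⟨ cong (λ β → toℚ (iverson β * b + e * m)) (eqB-refl cy) ⟩
      toℚ (1 * b + e * m)                        ≡⟨ toℚ-homo-+ (1 * b) (e * m) ⟩
      toℚ (1 * b) +ℚ toℚ (e * m)
        ≡⟨ cong₂ _+ℚ_ (cong toℚ (*-identityˡ b)) (scaled (fatβ k α) (π y) e (own (π y))) ⟩
      toℚ b +ℚ fatβ k α *ℚ toℚ (d * m)           ≡⟨ rescale-fatβ k α (toℚ b) (toℚ (d * m)) x-spec ⟩
      fatβ k (α *ℚ x) *ℚ (toℚ b +ℚ toℚ (d * m))  ≡⟨ cong (fatβ k (α *ℚ x) *ℚ_) (degᴴ y) ⟨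
      fatβ k (α *ℚ x) *ℚ toℚ (deg H y)           ∎
      where
      cy = c (π y)
      e  = eClass G c (π y) cy

product-cover : ∀ {n₁ n₂} (G : Adj n₁) {H : Adj (n₁ * n₂)} b m →
  (∀ v w u → count (λ j → H (combine v w) (combine u j)) ≡ iverson (eqB v u) * b + iverson (G v u) * m) →
  IsEquitableCover H G (proj₁ ∘ remQuot n₂) b m
product-cover {n₁} {n₂} G {H} b m fibre-count y P = begin
  count (λ z → H y z ∧ P (π z))
    ≡⟨ count≡∑ (λ z → H y z ∧ P (π z)) ⟩
  sum (λ z → iverson (H y z ∧ P (π z)))
    ≡⟨ ∑-combine n₁ _ ⟩
  ∑[ u < n₁ ] ∑[ j < n₂ ] iverson (H y (combine u j) ∧ P (π (combine u j)))
    ≡⟨ sum-cong-≗ fibre ⟩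
  ∑[ u < n₁ ] (iverson (eqB v u) * (iverson (P u) * b) + iverson (G v u ∧ P u) * m)
    ≡⟨ ∑-distrib-+ (λ u → iverson (eqB v u) * (iverson (P u) * b)) (λ u → iverson (G v u ∧ P u) * m) ⟩
  ∑[ u < n₁ ] (iverson (eqB v u) * (iverson (P u) * b)) + ∑[ u < n₁ ] (iverson (G v u ∧ P u) * m)
    ≡⟨ cong₂ _+_ (∑-δ v (λ u → iverson (P u) * b)) (sym (*-distribʳ-sum m (λ u → iverson (G v u ∧ P u)))) ⟩
  iverson (P v) * b + sum (λ u → iverson (G v u ∧ P u)) * m
    ≡⟨ cong (λ s → iverson (P v) * b + s * m) (count≡∑ (λ u → G v u ∧ P u)) ⟨
  iverson (P v) * b + count (λ u → G v u ∧ P u) * m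
    ∎
  where
  open ≡-Reasoning
  π = proj₁ ∘ remQuot {n₁} n₂
  v = proj₁ (remQuot {n₁} n₂ y)
  w = proj₂ (remQuot {n₁} n₂ y)

  in-fibre : ∀ u j → H y (combine u j) ∧ P (π (combine u j)) ≡ H (combine v w) (combine u j) ∧ P u
  in-fibre u j = cong₂ (λ y′ u′ → H y′ (combine u j) ∧ P u′)
                       (sym (combine-remQuot {n₁} n₂ y)) (cong proj₁ (remQuot-combine u j))

  regroup : ∀ a g p → (iverson a * b + iverson g * m) * iverson p
                      ≡ iverson a * (iverson p * b) + iverson (g ∧ p) * m
  regroup a g p =
    trans (solve 5 (λ A G P b m → (A :* b :+ G :* m) :* P := A :* (P :* b) :+ G :* P :* m) refl
                 (iverson a) (iverson g) (iverson p) b m)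
          (cong (λ s → iverson a * (iverson p * b) + s * m) (sym (iverson-∧ g p)))
    where open +-*-Solver

  fibre : ∀ u → ∑[ j < n₂ ] iverson (H y (combine u j) ∧ P (π (combine u j)))
                ≡ iverson (eqB v u) * (iverson (P u) * b) + iverson (G v u ∧ P u) * m
  fibre u = begin
    ∑[ j < n₂ ] iverson (H y (combine u j) ∧ P (π (combine u j)))
      ≡⟨ sum-cong-≗ (cong iverson ∘ in-fibre u) ⟩
    ∑[ j < n₂ ] iverson (H (combine v w) (combine u j) ∧ P u)
      ≡⟨ count≡∑ (λ j → H (combine v w) (combine u j) ∧ P u) ⟨
    count (λ j → H (combine v w) (combine u j) ∧ P u)
      ≡⟨ count-∧ʳ (λ j → H (combine v w) (combine u j)) (P u) ⟩
    count (λ j → H (combine v w) (combine u j)) * iverson (P u)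
      ≡⟨ cong (_* iverson (P u)) (fibre-count v w u) ⟩
    (iverson (eqB v u) * b + iverson (G v u) * m) * iverson (P u)
      ≡⟨ regroup (eqB v u) (G v u) (P u) ⟩
    iverson (eqB v u) * (iverson (P u) * b) + iverson (G v u ∧ P u) * m
      ∎

module _ {n₁ n₂ : ℕ} (G₁ : Adj n₁) (G₂ : Adj n₂) where

  cartesian-combine : ∀ v w u j →
    cartesian G₁ G₂ (combine v w) (combine u j) ≡ (eqB v u ∧ G₂ w j) ∨ (G₁ v u ∧ eqB w j)
  cartesian-combine v w u j =
    cong₂ (λ (x y : Fin n₁ × Fin n₂) → (eqB (proj₁ x) (proj₁ y) ∧ G₂ (proj₂ x) (proj₂ y))
                                        ∨ (G₁ (proj₁ x) (proj₁ y) ∧ eqB (proj₂ x) (proj₂ y)))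
          (remQuot-combine v w) (remQuot-combine u j)

  tensor-combine : ∀ v w u j → tensor G₁ G₂ (combine v w) (combine u j) ≡ G₁ v u ∧ G₂ w j
  tensor-combine v w u j =
    cong₂ (λ (x y : Fin n₁ × Fin n₂) → G₁ (proj₁ x) (proj₁ y) ∧ G₂ (proj₂ x) (proj₂ y))
          (remQuot-combine v w) (remQuot-combine u j)

  strong-combine : ∀ v w u j →
    strong G₁ G₂ (combine v w) (combine u j) ≡ (eqB v u ∧ G₂ w j) ∨ (G₁ v u ∧ (G₂ w j ∨ eqB w j))
  strong-combine v w u j =
    trans (cong₂ _∨_ (tensor-combine v w u j) (cartesian-combine v w u j))
          (regroup (G₁ v u) (eqB v u) (G₂ w j) (eqB w j))
    where
    regroup : ∀ g a x e → (g ∧ x) ∨ ((a ∧ x) ∨ (g ∧ e)) ≡ (a ∧ x) ∨ (g ∧ (x ∨ e))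
    regroup true  true  x e = refl
    regroup true  false x e = refl
    regroup false true  x e = refl
    regroup false false x e = refl

module _ {n₁ n₂ d₂ : ℕ} (G₁ : Adj n₁) (G₂ : Adj n₂)
         (loopless₁ : Loopless G₁) (regular₂ : IsRegular G₂ d₂) where

  cartesian-cover : IsEquitableCover (cartesian G₁ G₂) G₁ (proj₁ ∘ remQuot n₂) d₂ 1
  cartesian-cover = product-cover G₁ d₂ 1 λ v w u → begin
    count (λ j → cartesian G₁ G₂ (combine v w) (combine u j))
      ≡⟨ count-cong (cartesian-combine G₁ G₂ v w u) ⟩
    count (λ j → (eqB v u ∧ G₂ w j) ∨ (G₁ v u ∧ eqB w j))
      ≡⟨ count-select (eqB v u) (G₁ v u) (G₂ w) (eqB w) (eqB-∧-loopless loopless₁ v u) ⟩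
    iverson (eqB v u) * count (G₂ w) + iverson (G₁ v u) * count (eqB w)
      ≡⟨ cong₂ (λ s t → iverson (eqB v u) * s + iverson (G₁ v u) * t) (regular₂ w) (count-eqB w) ⟩
    iverson (eqB v u) * d₂ + iverson (G₁ v u) * 1
      ∎
    where open ≡-Reasoning

  module _ (loopless₂ : Loopless G₂) where

    closed-degree : ∀ w → count (λ j → G₂ w j ∨ eqB w j) ≡ suc d₂
    closed-degree w = begin
      count (λ j → G₂ w j ∨ eqB w j)
        ≡⟨ count-∨ (λ j → trans (∧-comm (G₂ w j) _) (eqB-∧-loopless loopless₂ w j)) ⟩
      count (G₂ w) + count (eqB w)
        ≡⟨ cong₂ _+_ (regular₂ w) (count-eqB w) ⟩
      d₂ + 1
        ≡⟨ +-comm d₂ 1 ⟩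
      suc d₂
        ∎
      where open ≡-Reasoning

    strong-cover : IsEquitableCover (strong G₁ G₂) G₁ (proj₁ ∘ remQuot n₂) d₂ (suc d₂)
    strong-cover = product-cover G₁ d₂ (suc d₂) λ v w u → begin
      count (λ j → strong G₁ G₂ (combine v w) (combine u j))
        ≡⟨ count-cong (strong-combine G₁ G₂ v w u) ⟩
      count (λ j → (eqB v u ∧ G₂ w j) ∨ (G₁ v u ∧ (G₂ w j ∨ eqB w j)))
        ≡⟨ count-select (eqB v u) (G₁ v u) (G₂ w) (λ j → G₂ w j ∨ eqB w j) (eqB-∧-loopless loopless₁ v u) ⟩
      iverson (eqB v u) * count (G₂ w) + iverson (G₁ v u) * count (λ j → G₂ w j ∨ eqB w j)
        ≡⟨ cong₂ (λ s t → iverson (eqB v u) * s + iverson (G₁ v u) * t) (regular₂ w) (closed-degree w) ⟩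
      iverson (eqB v u) * d₂ + iverson (G₁ v u) * suc d₂
        ∎
      where open ≡-Reasoning

nonZero-≡ : ∀ {m n} → m ≡ n → .{{NonZero m}} → NonZero n
nonZero-≡ {m} refl = ≢-nonZero (≢-nonZero⁻¹ m)

+/-cong : ∀ {a a′ d d′} .{{_ : NonZero d}} (a≡a′ : a ≡ a′) (d≡d′ : d ≡ d′) →
          + a / d ≡ (+ a′ / d′) {{nonZero-≡ d≡d′}}
+/-cong refl refl = refl

mainTheorem10 : (n₁ n₂ k d₁ d₂ : ℕ) (G₁ : Adj n₁) (G₂ : Adj n₂)
    → IsSimple G₁ → IsSimple G₂ → IsRegular G₁ d₁ → IsRegular G₂ d₂
    → (c : Fin n₁ → Fin k) (α : ℚ) → IsFAT G₁ c α
    → .{{_ : NonZero (d₁ + d₂)}}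
    → IsFAT (cartesian G₁ G₂) (liftColor {n₁} {n₂} c) (cartParam d₁ d₂ α)
      × IsFAT (strong G₁ G₂) (liftColor {n₁} {n₂} c) (strongParam d₁ d₂ α)
mainTheorem10 n₁ n₂ k d₁ d₂ G₁ G₂ simple₁ simple₂ regular₁ regular₂ c α fat =
    subst (IsFAT (cartesian G₁ G₂) (liftColor c)) cart-param
          (fat-lift (cartesian-cover G₁ G₂ loopless₁ regular₂) regular₁ fat)
  , subst (IsFAT (strong G₁ G₂) (liftColor c)) strong-param
          (fat-lift (strong-cover G₁ G₂ loopless₁ regular₂ loopless₂) regular₁ fat)
  where
  loopless₁ = IsSimple.loopless simple₁
  loopless₂ = IsSimple.loopless simple₂

  cart-den : d₁ + d₂ ≡ d₂ + d₁ * 1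
  cart-den = trans (+-comm d₁ d₂) (cong (_+_ d₂) (sym (*-identityʳ d₁)))

  strong-den : d₁ + d₂ + d₁ * d₂ ≡ d₂ + d₁ * suc d₂
  strong-den = solve 2 (λ d₁ d₂ → d₁ :+ d₂ :+ d₁ :* d₂ := d₂ :+ d₁ :* (con 1 :+ d₂)) refl d₁ d₂
    where open +-*-Solver

  instance
    _ : NonZero (d₂ + d₁ * 1)
    _ = nonZero-≡ cart-den
    _ : NonZero (d₂ + d₁ * suc d₂)
    _ = nonZero-≡ strong-den {{nz-strong d₁ d₂}}

  cart-param : α *ℚ (+ (d₁ * 1) / (d₂ + d₁ * 1)) ≡ cartParam d₁ d₂ α
  cart-param = cong (α *ℚ_) (sym (+/-cong (sym (*-identityʳ d₁)) cart-den))

  strong-param : α *ℚ (+ (d₁ * suc d₂) / (d₂ + d₁ * suc d₂)) ≡ strongParam d₁ d₂ α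
  strong-param = cong (α *ℚ_) (sym (+/-cong {{nz-strong d₁ d₂}} (sym (*-suc d₁ d₂)) strong-den))
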